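{- Let $T=(V,E)$ be a tree with at least two edges. Then the path polytope $P_T$ is contained in the hyperplane $\sum_{e\in E_{\mathrm{leaf}}(T)}x_e=2$ of $\mathbb{R}^E$. Consequently $\mathrm{conv}(P_T\cup\{\mathbf{0}\})$ is the free join of $P_T$ and $\{\mathbf{0}\}$, i.e. $\dim\mathrm{conv}(P_T\cup\{\mathbf 0\})=\dim P_T+1$.
   Context: A tree is a finite connected acyclic graph; leaves are vertices of degree $1$ and $E_{\mathrm{leaf}}(T)$ is the set of edges having a leaf as an endpoint. For distinct leaves $i,j$, $\mathbf{c}^{i\leftrightarrow j}\in\{0,1\}^E$ is the indicator vector of the edges of the path from $i$ to $j$, and $P_T=\mathrm{conv}\{\mathbf{c}^{i\leftrightarrow j}: i\neq j \text{ leaves}\}\subset\mathbb{R}^E$. For polytopes $P,Q$ with $\dim\mathrm{conv}(P\cup Q)=\dim P+\dim Q+1$, the polytope $\mathrm{conv}(P\cup Q)$ is called the free join of $P$ and $Q$.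
   Formalization: The path polytope $P_T$ and $\mathrm{conv}(P_T\cup\{\mathbf{0}\})$ are taken in ℚ^E rather than $\mathbb{R}^E$, with rational convex-combination weights, and their affine dimensions are computed over ℚ. -}

module Defs where

open import Data.Nat using (ℕ; zero; suc; _≤_)
open import Data.Fin using (Fin)
open import Data.Fin.Properties using () renaming (_≟_ to _≟ᶠ_)
open import Data.List using (List; []; _∷_; length; filter; allFin)
open import Data.List.Relation.Unary.Unique.Propositional using (Unique)
open import Data.List.Membership.Propositional using (_∈_)
open import Data.Product using (Σ; _×_; _,_; ∃)
open import Data.Sum using (_⊎_)
open import Relation.Binary.PropositionalEquality using (_≡_; _≢_)
open import Relation.Nullary using (¬_; Dec; yes; no)
open import Relation.Nullary.Decidable using (_⊎-dec_)
open import Data.Rational using (ℚ; 0ℚ; 1ℚ; _+_; _*_) renaming (_≤_ to _≤ℚ_)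

record Graph : Set where
  field
    n m  : ℕ
    src  : Fin m → Fin n
    tgt  : Fin m → Fin n
    loopless : ∀ e → src e ≢ tgt e
    noParallel : ∀ e f →
      ((src e ≡ src f × tgt e ≡ tgt f) ⊎ (src e ≡ tgt f × tgt e ≡ src f)) →
      e ≡ f

open Graph public

Vertex : Graph → Set
Vertex G = Fin (n G)

Edge : Graph → Set
Edge G = Fin (m G)

Joins : (G : Graph) → Edge G → Vertex G → Vertex G → Set
Joins G e u w = (src G e ≡ u × tgt G e ≡ w) ⊎ (src G e ≡ w × tgt G e ≡ u)

data Walk (G : Graph) : Vertex G → Vertex G → List (Vertex G) → List (Edge G) → Set where
  here : ∀ {v} → Walk G v v (v ∷ []) []
  step : ∀ {u w v vs es} (e : Edge G) → Joins G e u w →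
         Walk G w v vs es → Walk G u v (u ∷ vs) (e ∷ es)

Path : (G : Graph) → Vertex G → Vertex G → List (Vertex G) → List (Edge G) → Set
Path G u v vs es = Walk G u v vs es × Unique vs

Connected : Graph → Set
Connected G = ∀ (u v : Vertex G) → Σ (List (Vertex G)) λ vs → Σ (List (Edge G)) λ es → Walk G u v vs es

-- A cycle: a closed walk u → u with at least 3 edges whose vertices
-- v0, …, v(k-1) (the closing repetition of u removed) are distinct.
Cycle : (G : Graph) → Set
Cycle G = Σ (Vertex G) λ u → Σ (List (Vertex G)) λ vs → Σ (List (Edge G)) λ es →
  Walk G u u (u ∷ vs) es × Unique vs × 3 ≤ length es

Acyclic : Graph → Set
Acyclic G = ¬ Cycle G

IsTree : Graph → Set
IsTree G = Connected G × Acyclic G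

incident? : (G : Graph) (v : Vertex G) (e : Edge G) → Dec (src G e ≡ v ⊎ tgt G e ≡ v)
incident? G v e = (src G e ≟ᶠ v) ⊎-dec (tgt G e ≟ᶠ v)

degree : (G : Graph) → Vertex G → ℕ
degree G v = length (filter (incident? G v) (allFin (m G)))

IsLeaf : (G : Graph) → Vertex G → Set
IsLeaf G v = degree G v ≡ 1

IsLeafEdge : (G : Graph) → Edge G → Set
IsLeafEdge G e = IsLeaf G (src G e) ⊎ IsLeaf G (tgt G e)

Vector : ℕ → Set
Vector k = Fin k → ℚ

Σℚ : ∀ {k} → (Fin k → ℚ) → ℚ
Σℚ {zero}  f = 0ℚ
Σℚ {suc k} f = f Fin.zero + Σℚ (λ i → f (Fin.suc i))
  where import Data.Fin as Fin

ΣℚOver : ∀ {k} (P : Fin k → Set) → (∀ i → Dec (P i)) → (Fin k → ℚ) → ℚ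
ΣℚOver P P? x = Σℚ (λ i → ind (P? i) (x i))
  where
  ind : ∀ {A : Set} → Dec A → ℚ → ℚ
  ind (yes _) q = q
  ind (no _)  _ = 0ℚ

Subset : ℕ → Set₁
Subset k = Vector k → Set

conv : ∀ {k} → Subset k → Subset k
conv {k} S x = Σ ℕ λ r → Σ (Fin r → ℚ) λ μ → Σ (Fin r → Vector k) λ p →
  (∀ i → S (p i)) × (∀ i → 0ℚ ≤ℚ μ i) × Σℚ μ ≡ 1ℚ ×
  (∀ e → x e ≡ Σℚ (λ i → μ i * p i e))

_∪_ : ∀ {k} → Subset k → Subset k → Subset k
(S ∪ S') x = S x ⊎ S' x

zeroVec : ∀ {k} → Vector k
zeroVec _ = 0ℚ

singleton : ∀ {k} → Vector k → Subset k
singleton y x = ∀ e → x e ≡ y e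

AffinelyIndependent : ∀ {k r} → (Fin r → Vector k) → Set
AffinelyIndependent {k} {r} p = ∀ (λ' : Fin r → ℚ) → Σℚ λ' ≡ 0ℚ →
  (∀ e → Σℚ (λ i → λ' i * p i e) ≡ 0ℚ) → ∀ i → λ' i ≡ 0ℚ

-- dim S = d : the affine hull of S has dimension d, i.e. S contains d+1
-- affinely independent points and no more.
HasDim : ∀ {k} → Subset k → ℕ → Set
HasDim {k} S d =
  (Σ (Fin (suc d) → Vector k) λ p → (∀ i → S (p i)) × AffinelyIndependent p) ×
  (∀ r (p : Fin r → Vector k) → (∀ i → S (p i)) → AffinelyIndependent p → r ≤ suc d)

IsPathVector : (G : Graph) → Vertex G → Vertex G → Vector (m G) → Set
IsPathVector G i j x = Σ (List (Vertex G)) λ vs → Σ (List (Edge G)) λ es →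
  Path G i j vs es × (∀ e → (e ∈ es → x e ≡ 1ℚ) × (¬ e ∈ es → x e ≡ 0ℚ))

PathVectors : (G : Graph) → Subset (m G)
PathVectors G x = Σ (Vertex G) λ i → Σ (Vertex G) λ j →
  IsLeaf G i × IsLeaf G j × i ≢ j × IsPathVector G i j x

PathPolytope : (G : Graph) → Subset (m G)
PathPolytope G = conv (PathVectors G)

isLeafEdge? : (G : Graph) (e : Edge G) → Dec (IsLeafEdge G e)
isLeafEdge? G e = (degree G (src G e) ≟ 1) ⊎-dec (degree G (tgt G e) ≟ 1)
  where open import Data.Nat.Properties using (_≟_)

leafEdgeSum : (G : Graph) → Vector (m G) → ℚ
leafEdgeSum G x = ΣℚOver (IsLeafEdge G) (isLeafEdge? G) x

2ℚ : ℚ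
2ℚ = 1ℚ + 1ℚ

-- A leaf-to-leaf path in a tree with at least two edges contains exactly two leaf edges, its first
-- and its last edge.  They differ because, by connectivity, an edge joining two leaves would be the
-- only edge.  So every path vector, and hence all of P_T, lies in the hyperplane
-- Σ_{e ∈ E_leaf} x_e = 2, which misses 0.
--
-- Dimensions are witnessed by affine bases.  There are only finitely many path vectors (their vertex
-- lists have length at most |V|), and a greedy pass over them gives an affinely independent family
-- whose affine hull contains P_T.  Adding 0 keeps the family independent, because the leaf-edge sum
-- is 2 on the family and 0 at 0.  Gaussian elimination over ℚ shows that no independent family
-- inside an affine hull is larger than the family spanning it.

module Submission where

open import Defs
open import Data.Nat using (ℕ; suc; _≤_)
open import Data.Product using (Σ; _×_)
open import Relation.Binary.PropositionalEquality using (_≡_)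

open import Algebra.Bundles using (CommutativeRing)
open import Data.Empty using (⊥; ⊥-elim)
open import Data.Fin using (Fin; zero; suc; punchIn)
open import Data.Fin.Properties using (any?; injective⇒≤; 0≢1+n; punchIn-punchOut; punchInᵢ≢i)
  renaming (_≟_ to _≟ᶠ_)
open import Data.List using (List; []; _∷_; _++_; length; lookup; filter; allFin; map; cartesianProduct)
open import Data.List.Membership.Propositional using (_∈_; _∉_)
open import Data.List.Membership.Propositional.Properties
  using (∈-filter⁺; ∈-filter⁻; ∈-allFin; ∈-lookup; ∈-map⁺; ∈-cartesianProduct⁺)
open import Data.List.Relation.Unary.All as All using (All; []; _∷_)
open import Data.List.Relation.Unary.All.Properties using (¬Any⇒All¬; All¬⇒¬Any)
open import Data.List.Relation.Unary.AllPairs using ([]; _∷_)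
open import Data.List.Relation.Unary.Any as Any using (Any; here; there)
open import Data.List.Relation.Unary.Unique.Propositional using (Unique)
open import Data.List.Relation.Unary.Unique.Propositional.Properties using (allFin⁺; filter⁺; ++⁺)
open import Data.Nat using (zero; _<_; z≤n; s≤s)
import Data.Nat as ℕ
import Data.Nat.Properties as ℕ
open import Data.Product using (∃; ∃₂; Σ-syntax; ∃-syntax; _,_; proj₁; proj₂; uncurry)
open import Data.Rational using (ℚ; 0ℚ; 1ℚ; _+_; _-_; _*_; -_; 1/_; NonZero; ≢-nonZero)
open import Data.Rational.Properties
  using ( +-*-commutativeRing; nonNegative⁻¹; +-identityˡ; +-identityʳ; *-comm; *-assoc
        ; *-identityˡ; *-identityʳ; *-zeroˡ; *-zeroʳ; *-inverseˡ)
  renaming (_≟_ to _≟ℚ_)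
open import Data.Rational.Solver using (module +-*-Solver)
open import Data.Sum using (_⊎_; inj₁; inj₂)
open import Data.Vec.Functional using (tail; removeAt) renaming (_∷_ to _∷ᵛ_)
open import Function using (_∘_; const)
open import Relation.Binary.PropositionalEquality
  using (refl; sym; trans; cong; cong₂; subst; _≢_; _≗_; module ≡-Reasoning)
open import Relation.Nullary using (¬_; ¬?; Dec; yes; no)
open import Relation.Nullary.Decidable using (_×-dec_; _⊎-dec_; decidable-stable)
open import Relation.Unary using (_⊆_)

open import Algebra.Properties.Semiring.Sum (CommutativeRing.semiring +-*-commutativeRing)
  using (sum; sum-cong-≗; sum-remove; sum-replicate-zero; ∑-distrib-+; ∑-comm; *-distribˡ-sum; *-distribʳ-sum)
open +-*-Solver

private
  variable
    k r s d : ℕ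

Σℚ≡sum : (f : Fin k → ℚ) → Σℚ f ≡ sum f
Σℚ≡sum {zero}  f = refl
Σℚ≡sum {suc k} f = cong (f zero +_) (Σℚ≡sum (f ∘ suc))

Σℚ-cong : {f g : Fin k → ℚ} → f ≗ g → Σℚ f ≡ Σℚ g
Σℚ-cong {k} {f} {g} f≗g = trans (Σℚ≡sum f) (trans (sum-cong-≗ {k} {f} {g} f≗g) (sym (Σℚ≡sum g)))

Σℚ-zero : {f : Fin k → ℚ} → f ≗ const 0ℚ → Σℚ f ≡ 0ℚ
Σℚ-zero {k} f≗0 = trans (Σℚ-cong f≗0) (trans (Σℚ≡sum {k} (const 0ℚ)) (sum-replicate-zero k))

Σℚ-distrib-+ : (f g : Fin k → ℚ) → Σℚ (λ i → f i + g i) ≡ Σℚ f + Σℚ g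
Σℚ-distrib-+ f g = begin
  Σℚ (λ i → f i + g i)   ≡⟨ Σℚ≡sum (λ i → f i + g i) ⟩
  sum (λ i → f i + g i)  ≡⟨ ∑-distrib-+ f g ⟩
  sum f + sum g          ≡⟨ cong₂ _+_ (Σℚ≡sum f) (Σℚ≡sum g) ⟨
  Σℚ f + Σℚ g            ∎
  where open ≡-Reasoning

*-distribˡ-Σℚ : ∀ c (f : Fin k → ℚ) → c * Σℚ f ≡ Σℚ (λ i → c * f i)
*-distribˡ-Σℚ c f = begin
  c * Σℚ f             ≡⟨ cong (c *_) (Σℚ≡sum f) ⟩
  c * sum f            ≡⟨ *-distribˡ-sum c f ⟩
  sum (λ i → c * f i)  ≡⟨ Σℚ≡sum (λ i → c * f i) ⟨
  Σℚ (λ i → c * f i)   ∎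
  where open ≡-Reasoning

*-distribʳ-Σℚ : ∀ c (f : Fin k → ℚ) → Σℚ f * c ≡ Σℚ (λ i → f i * c)
*-distribʳ-Σℚ c f = begin
  Σℚ f * c             ≡⟨ cong (_* c) (Σℚ≡sum f) ⟩
  sum f * c            ≡⟨ *-distribʳ-sum c f ⟩
  sum (λ i → f i * c)  ≡⟨ Σℚ≡sum (λ i → f i * c) ⟨
  Σℚ (λ i → f i * c)   ∎
  where open ≡-Reasoning

Σℚ-comm : (f : Fin k → Fin r → ℚ) → Σℚ (λ i → Σℚ (f i)) ≡ Σℚ (λ j → Σℚ (λ i → f i j))
Σℚ-comm f = begin
  Σℚ (λ i → Σℚ (f i))
    ≡⟨ trans (Σℚ-cong (Σℚ≡sum ∘ f)) (Σℚ≡sum (λ i → sum (f i))) ⟩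
  sum (λ i → sum (f i))
    ≡⟨ ∑-comm f ⟩
  sum (λ j → sum (λ i → f i j))
    ≡⟨ trans (Σℚ-cong (λ j → Σℚ≡sum (λ i → f i j))) (Σℚ≡sum (λ j → sum (λ i → f i j))) ⟨
  Σℚ (λ j → Σℚ (λ i → f i j))
    ∎
  where open ≡-Reasoning

Σℚ-removeAt : (f : Fin (suc k) → ℚ) (a : Fin (suc k)) → Σℚ f ≡ f a + Σℚ (removeAt f a)
Σℚ-removeAt {k} f a =
  trans (Σℚ≡sum f) (trans (sum-remove {k} {a} f) (cong (f a +_) (sym (Σℚ≡sum (removeAt f a)))))

_·_ : (Fin r → ℚ) → (Fin r → ℚ) → ℚ
l · a = Σℚ (λ j → l j * a j)

onlyIf : {P : Set} → Dec P → ℚ → ℚ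
onlyIf (yes _) q = q
onlyIf (no _)  _ = 0ℚ

onlyIf-yes : {P : Set} (P? : Dec P) {q : ℚ} → P → onlyIf P? q ≡ q
onlyIf-yes (yes _) _ = refl
onlyIf-yes (no ¬p) p = ⊥-elim (¬p p)

onlyIf-no : {P : Set} (P? : Dec P) {q : ℚ} → ¬ P → onlyIf P? q ≡ 0ℚ
onlyIf-no (yes p) ¬p = ⊥-elim (¬p p)
onlyIf-no (no _)  _  = refl

onlyIf-onlyIf : {P Q : Set} (P? : Dec P) (Q? : Dec Q) (q : ℚ) →
  onlyIf P? (onlyIf Q? q) ≡ onlyIf (P? ×-dec Q?) q
onlyIf-onlyIf (yes _) (yes _) q = refl
onlyIf-onlyIf (yes _) (no _)  q = refl
onlyIf-onlyIf (no _)  _       q = refl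

onlyIf-· : {P : Set} (P? : Dec P) (μ q : Fin r → ℚ) → onlyIf P? (μ · q) ≡ μ · (λ i → onlyIf P? (q i))
onlyIf-· (yes _) μ q = refl
onlyIf-· (no _)  μ q = sym (Σℚ-zero (λ i → *-zeroʳ (μ i)))

ΣℚOver≡Σℚ-onlyIf : (P : Fin k → Set) (P? : ∀ i → Dec (P i)) (x : Vector k) →
  ΣℚOver P P? x ≡ Σℚ (λ i → onlyIf (P? i) (x i))
ΣℚOver≡Σℚ-onlyIf {zero}  P P? x = refl
ΣℚOver≡Σℚ-onlyIf {suc k} P P? x with P? zero
... | yes _ = cong (x zero +_) (ΣℚOver≡Σℚ-onlyIf (P ∘ suc) (P? ∘ suc) (x ∘ suc))
... | no _  = cong (0ℚ +_) (ΣℚOver≡Σℚ-onlyIf (P ∘ suc) (P? ∘ suc) (x ∘ suc))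

Σℚ-δ : (a : Fin k) → Σℚ (λ e → onlyIf (a ≟ᶠ e) 1ℚ) ≡ 1ℚ
Σℚ-δ {suc k} a = begin
  Σℚ δₐ                      ≡⟨ Σℚ-removeAt δₐ a ⟩
  δₐ a + Σℚ (removeAt δₐ a)  ≡⟨ cong₂ _+_ (onlyIf-yes (a ≟ᶠ a) refl) (Σℚ-zero δₐ∘punchIn≗0) ⟩
  1ℚ + 0ℚ                    ≡⟨ +-identityʳ 1ℚ ⟩
  1ℚ                         ∎
  where
  open ≡-Reasoning
  δₐ : Fin (suc k) → ℚ
  δₐ e = onlyIf (a ≟ᶠ e) 1ℚ
  δₐ∘punchIn≗0 : removeAt δₐ a ≗ const 0ℚ
  δₐ∘punchIn≗0 j = onlyIf-no (a ≟ᶠ punchIn a j) (punchInᵢ≢i a j ∘ sym)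

Σℚ-onlyIf-pair : {P : Fin k → Set} {a b : Fin k} → a ≢ b → (P? : ∀ e → Dec (P e)) →
  P a → P b → (∀ {e} → P e → e ≡ a ⊎ e ≡ b) → Σℚ (λ e → onlyIf (P? e) 1ℚ) ≡ 2ℚ
Σℚ-onlyIf-pair {a = a} {b} a≢b P? Pa Pb P⇒a∨b = begin
  Σℚ (λ e → onlyIf (P? e) 1ℚ)          ≡⟨ Σℚ-cong split ⟩
  Σℚ (λ e → δ a e + δ b e)             ≡⟨ Σℚ-distrib-+ (δ a) (δ b) ⟩
  Σℚ (δ a) + Σℚ (δ b)                  ≡⟨ cong₂ _+_ (Σℚ-δ a) (Σℚ-δ b) ⟩
  2ℚ                                   ∎
  where
  open ≡-Reasoning
  δ : Fin _ → Fin _ → ℚ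
  δ c e = onlyIf (c ≟ᶠ e) 1ℚ
  split : ∀ e → onlyIf (P? e) 1ℚ ≡ δ a e + δ b e
  split e with P? e
  ... | no ¬Pe =
    sym (cong₂ _+_ (onlyIf-no (a ≟ᶠ e) λ { refl → ¬Pe Pa }) (onlyIf-no (b ≟ᶠ e) λ { refl → ¬Pe Pb }))
  ... | yes Pe with P⇒a∨b Pe
  ...   | inj₁ refl =
    sym (trans (cong₂ _+_ (onlyIf-yes (a ≟ᶠ a) refl) (onlyIf-no (b ≟ᶠ a) (a≢b ∘ sym))) (+-identityʳ 1ℚ))
  ...   | inj₂ refl =
    sym (trans (cong₂ _+_ (onlyIf-no (a ≟ᶠ b) a≢b) (onlyIf-yes (b ≟ᶠ b) refl)) (+-identityˡ 1ℚ))

p*q≡0⇒q≡0 : ∀ p .{{_ : NonZero p}} {q} → p * q ≡ 0ℚ → q ≡ 0ℚ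
p*q≡0⇒q≡0 p {q} pq≡0 = begin
  q               ≡⟨ *-identityˡ q ⟨
  1ℚ * q          ≡⟨ cong (_* q) (*-inverseˡ p) ⟨
  (1/ p * p) * q  ≡⟨ *-assoc (1/ p) p q ⟩
  1/ p * (p * q)  ≡⟨ cong (1/ p *_) pq≡0 ⟩
  1/ p * 0ℚ       ≡⟨ *-zeroʳ (1/ p) ⟩
  0ℚ              ∎
  where open ≡-Reasoning

p*y+t≡0⇒-t/p≡y : ∀ p .{{_ : NonZero p}} {y t} → p * y + t ≡ 0ℚ → - (1/ p) * t ≡ y
p*y+t≡0⇒-t/p≡y p {y} {t} eq = begin
  - (1/ p) * t
    ≡⟨ solve 4 (λ p′ p y t → :- p′ :* t := :- p′ :* (p :* y :+ t) :+ (p′ :* p) :* y) refl (1/ p) p y t ⟩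
  - (1/ p) * (p * y + t) + (1/ p * p) * y
    ≡⟨ cong₂ (λ u v → - (1/ p) * u + v * y) eq (*-inverseˡ p) ⟩
  - (1/ p) * 0ℚ + 1ℚ * y
    ≡⟨ solve 2 (λ p′ y → :- p′ :* con 0ℚ :+ con 1ℚ :* y := y) refl (1/ p) y ⟩
  y
    ∎
  where open ≡-Reasoning

-t/p*p+t≡0 : ∀ p .{{_ : NonZero p}} t → (- (1/ p) * t) * p + t ≡ 0ℚ
-t/p*p+t≡0 p t = begin
  (- (1/ p) * t) * p + t  ≡⟨ solve 3 (λ p′ p t → (:- p′ :* t) :* p :+ t := t :- t :* (p′ :* p)) refl (1/ p) p t ⟩
  t - t * (1/ p * p)      ≡⟨ cong (λ u → t - t * u) (*-inverseˡ p) ⟩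
  t - t * 1ℚ              ≡⟨ solve 1 (λ t → t :- t :* con 1ℚ := con 0ℚ) refl t ⟩
  0ℚ                      ∎
  where open ≡-Reasoning

-- Homogeneous linear systems

Solves : (Fin s → Fin r → ℚ) → (Fin r → ℚ) → Set
Solves A l = ∀ i → l · A i ≡ 0ℚ

Nontrivial : (Fin r → ℚ) → Set
Nontrivial l = ∃[ j ] l j ≢ 0ℚ

OnlyTrivialSolution : (Fin s → Fin r → ℚ) → Set
OnlyTrivialSolution A = ∀ l → Solves A l → ∀ j → l j ≡ 0ℚ

HomogeneousDichotomy : (Fin s → Fin r → ℚ) → Set
HomogeneousDichotomy {s} {r} A = (∃[ l ] Nontrivial l × Solves A l) ⊎ (OnlyTrivialSolution A × r ≤ s)

e₀ : Fin (suc r) → ℚ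
e₀ = 1ℚ ∷ᵛ const 0ℚ

e₀-nontrivial : Nontrivial (e₀ {r})
e₀-nontrivial = zero , λ ()

e₀·a≡a₀ : (a : Fin (suc r) → ℚ) → e₀ · a ≡ a zero
e₀·a≡a₀ a = begin
  1ℚ * a zero + Σℚ (λ j → 0ℚ * a (suc j))  ≡⟨ cong₂ _+_ (*-identityˡ (a zero)) (Σℚ-zero (*-zeroˡ ∘ a ∘ suc)) ⟩
  a zero + 0ℚ                              ≡⟨ +-identityʳ (a zero) ⟩
  a zero                                   ∎
  where open ≡-Reasoning

module Pivot (A : Fin (suc s) → Fin (suc r) → ℚ) (k : Fin (suc s)) .{{_ : NonZero (A k zero)}} where

  private
    p : ℚ
    p = A k zero

  -- p · (row punchIn k i) − A (punchIn k i) zero · (row k), whose first entry is 0, without that entry: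
  -- elimination of the first unknown, scaled by the pivot p so that no division occurs.
  reduced : Fin s → Fin r → ℚ
  reduced i j = p * A (punchIn k i) (suc j) - A (punchIn k i) zero * A k (suc j)

  reduced-· : ∀ l i → tail l · reduced i ≡ p * (l · A (punchIn k i)) - A (punchIn k i) zero * (l · A k)
  reduced-· l i = begin
    tail l · reduced i
      ≡⟨ Σℚ-cong (λ j → solve 5 (λ μ p c a b → μ :* (p :* a :- c :* b) := p :* (μ :* a) :+ (:- c) :* (μ :* b))
                                refl (μ j) p c (a j) (b j)) ⟩
    Σℚ (λ j → p * (μ j * a j) + (- c) * (μ j * b j))
      ≡⟨ Σℚ-distrib-+ (λ j → p * (μ j * a j)) (λ j → (- c) * (μ j * b j)) ⟩
    Σℚ (λ j → p * (μ j * a j)) + Σℚ (λ j → (- c) * (μ j * b j))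
      ≡⟨ cong₂ _+_ (*-distribˡ-Σℚ p (λ j → μ j * a j)) (*-distribˡ-Σℚ (- c) (λ j → μ j * b j)) ⟨
    p * (μ · a) + (- c) * (μ · b)
      ≡⟨ solve 5 (λ l₀ p c a b → p :* a :+ (:- c) :* b := p :* (l₀ :* c :+ a) :- c :* (l₀ :* p :+ b))
                 refl (l zero) p c (μ · a) (μ · b) ⟩
    p * (l · A (punchIn k i)) - c * (l · A k)
      ∎
    where
    open ≡-Reasoning
    μ = tail l
    a = tail (A (punchIn k i))
    b = tail (A k)
    c = A (punchIn k i) zero

  lift : (Fin r → ℚ) → Fin (suc r) → ℚ
  lift μ = (- (1/ p) * (μ · tail (A k))) ∷ᵛ μ

  lift-solves-pivot-row : ∀ μ → lift μ · A k ≡ 0ℚ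
  lift-solves-pivot-row μ = -t/p*p+t≡0 p (μ · tail (A k))

  lift-solves-other-row : ∀ μ → Solves reduced μ → ∀ i → lift μ · A (punchIn k i) ≡ 0ℚ
  lift-solves-other-row μ sol i = p*q≡0⇒q≡0 p (begin
    p * x                    ≡⟨ solve 3 (λ x c y → x := (x :- c :* y) :+ c :* y) refl (p * x) c y ⟩
    (p * x - c * y) + c * y  ≡⟨ cong₂ (λ u v → u + c * v) (trans (sym (reduced-· (lift μ) i)) (sol i))
                                                        (lift-solves-pivot-row μ) ⟩
    0ℚ + c * 0ℚ              ≡⟨ solve 1 (λ c → con 0ℚ :+ c :* con 0ℚ := con 0ℚ) refl c ⟩
    0ℚ                       ∎)
    where
    open ≡-Reasoning
    x = lift μ · A (punchIn k i)
    y = lift μ · A k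
    c = A (punchIn k i) zero

  lift-solves : ∀ μ → Solves reduced μ → Solves A (lift μ)
  lift-solves μ sol i with i ≟ᶠ k
  ... | yes refl = lift-solves-pivot-row μ
  ... | no i≢k   =
    subst (λ i → lift μ · A i ≡ 0ℚ) (punchIn-punchOut (i≢k ∘ sym)) (lift-solves-other-row μ sol _)

  tail-solves : ∀ l → Solves A l → Solves reduced (tail l)
  tail-solves l sol i = begin
    tail l · reduced i                         ≡⟨ reduced-· l i ⟩
    p * (l · A (punchIn k i)) - c * (l · A k)  ≡⟨ cong₂ (λ u v → p * u - c * v) (sol (punchIn k i)) (sol k) ⟩
    p * 0ℚ - c * 0ℚ                            ≡⟨ solve 2 (λ p c → p :* con 0ℚ :- c :* con 0ℚ := con 0ℚ) refl p c ⟩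
    0ℚ                                         ∎
    where
    open ≡-Reasoning
    c = A (punchIn k i) zero

  head-determined : ∀ l → Solves A l → tail l ≗ const 0ℚ → l zero ≡ 0ℚ
  head-determined l sol tail≗0 = p*q≡0⇒q≡0 p (begin
    p * l zero       ≡⟨ *-comm p (l zero) ⟩
    l zero * p       ≡⟨ +-identityʳ (l zero * p) ⟨
    l zero * p + 0ℚ  ≡⟨ cong (l zero * p +_) (Σℚ-zero tail-terms≗0) ⟨
    l · A k          ≡⟨ sol k ⟩
    0ℚ               ∎)
    where
    open ≡-Reasoning
    tail-terms≗0 : (λ j → l (suc j) * A k (suc j)) ≗ const 0ℚ
    tail-terms≗0 j = trans (cong (_* A k (suc j)) (tail≗0 j)) (*-zeroˡ (A k (suc j)))

homogeneous-dichotomy : ∀ s r (A : Fin s → Fin r → ℚ) → HomogeneousDichotomy A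
homogeneous-dichotomy s       zero    A = inj₂ ((λ _ _ ()) , z≤n)
homogeneous-dichotomy zero    (suc r) A = inj₁ (e₀ , e₀-nontrivial , λ ())
homogeneous-dichotomy (suc s) (suc r) A with any? (λ i → ¬? (A i zero ≟ℚ 0ℚ))
... | no noPivot = inj₁ (e₀ , e₀-nontrivial , λ i → trans (e₀·a≡a₀ (A i)) (first-column≡0 i))
  where
  first-column≡0 : ∀ i → A i zero ≡ 0ℚ
  first-column≡0 i = decidable-stable (A i zero ≟ℚ 0ℚ) (λ A[i,0]≢0 → noPivot (i , A[i,0]≢0))
... | yes (k , A[k,0]≢0) = from-reduced (homogeneous-dichotomy s r reduced)
  where
  instance _ = ≢-nonZero A[k,0]≢0
  open Pivot A k
  from-reduced : HomogeneousDichotomy reduced → HomogeneousDichotomy A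
  from-reduced (inj₁ (μ , (j , μj≢0) , sol)) = inj₁ (lift μ , (suc j , μj≢0) , lift-solves μ sol)
  from-reduced (inj₂ (trivial , r≤s))        = inj₂ (only-trivial , s≤s r≤s)
    where
    only-trivial : OnlyTrivialSolution A
    only-trivial l sol zero    = head-determined l sol (trivial (tail l) (tail-solves l sol))
    only-trivial l sol (suc j) = trivial (tail l) (tail-solves l sol) j

-- Affine hulls and affine bases

combination : (Fin r → ℚ) → (Fin r → Vector k) → Vector k
combination μ p e = μ · (λ i → p i e)

AffineHull : (Fin d → Vector k) → Subset k
AffineHull {d} B x = Σ[ a ∈ (Fin d → ℚ) ] Σℚ a ≡ 1ℚ × x ≗ combination a B

AffinelyDependent : (Fin r → Vector k) → Set
AffinelyDependent p = Σ[ l ∈ _ ] Nontrivial l × Σℚ l ≡ 0ℚ × combination l p ≗ const 0ℚ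

·-const1 : (l : Fin r → ℚ) → l · const 1ℚ ≡ Σℚ l
·-const1 l = Σℚ-cong (*-identityʳ ∘ l)

dependent⊎independent : (p : Fin r → Vector k) → AffinelyDependent p ⊎ AffinelyIndependent p
dependent⊎independent {r} {k} p with homogeneous-dichotomy (suc k) r (const 1ℚ ∷ᵛ λ e i → p i e)
... | inj₁ (l , nontrivial , sol) = inj₁ (l , nontrivial , trans (sym (·-const1 l)) (sol zero) , sol ∘ suc)
... | inj₂ (trivial , _)          = inj₂ λ l Σl≡0 comb≗0 → trivial l λ where
  zero    → trans (·-const1 l) Σl≡0
  (suc e) → comb≗0 e

module _ {B : Fin d → Vector k} {q : Fin r → Vector k} (q∈hull : ∀ i → AffineHull B (q i)) (μ : Fin r → ℚ)
  where

  private
    a : Fin r → Fin d → ℚ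
    a i = proj₁ (q∈hull i)

  hull-coefficients : Fin d → ℚ
  hull-coefficients t = Σℚ (λ i → μ i * a i t)

  Σℚ-hull-coefficients : Σℚ hull-coefficients ≡ Σℚ μ
  Σℚ-hull-coefficients = begin
    Σℚ (λ t → Σℚ (λ i → μ i * a i t))  ≡⟨ Σℚ-comm (λ i t → μ i * a i t) ⟨
    Σℚ (λ i → Σℚ (λ t → μ i * a i t))  ≡⟨ Σℚ-cong (λ i → *-distribˡ-Σℚ (μ i) (a i)) ⟨
    Σℚ (λ i → μ i * Σℚ (a i))          ≡⟨ Σℚ-cong (λ i → trans (cong (μ i *_) (Σa≡1 i)) (*-identityʳ (μ i))) ⟩
    Σℚ μ                               ∎
    where
    open ≡-Reasoning
    Σa≡1 : ∀ i → Σℚ (a i) ≡ 1ℚ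
    Σa≡1 i = proj₁ (proj₂ (q∈hull i))

  combination-hull-coefficients : combination μ q ≗ combination hull-coefficients B
  combination-hull-coefficients e = begin
    Σℚ (λ i → μ i * q i e)                       ≡⟨ Σℚ-cong (λ i → cong (μ i *_) (proj₂ (proj₂ (q∈hull i)) e)) ⟩
    Σℚ (λ i → μ i * Σℚ (λ t → a i t * B t e))    ≡⟨ Σℚ-cong (λ i → *-distribˡ-Σℚ (μ i) (λ t → a i t * B t e)) ⟩
    Σℚ (λ i → Σℚ (λ t → μ i * (a i t * B t e)))  ≡⟨ Σℚ-comm (λ i t → μ i * (a i t * B t e)) ⟩
    Σℚ (λ t → Σℚ (λ i → μ i * (a i t * B t e)))  ≡⟨ Σℚ-cong (λ t → Σℚ-cong (λ i → *-assoc (μ i) (a i t) (B t e))) ⟨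
    Σℚ (λ t → Σℚ (λ i → μ i * a i t * B t e))    ≡⟨ Σℚ-cong (λ t → *-distribʳ-Σℚ (B t e) (λ i → μ i * a i t)) ⟨
    Σℚ (λ t → hull-coefficients t * B t e)       ∎
    where open ≡-Reasoning

conv⊆AffineHull : {S : Subset k} {B : Fin d → Vector k} → S ⊆ AffineHull B → conv S ⊆ AffineHull B
conv⊆AffineHull S⊆hull (r , μ , p , p∈S , _ , Σμ≡1 , x≗μp) =
  hull-coefficients q∈hull μ , trans (Σℚ-hull-coefficients q∈hull μ) Σμ≡1 ,
  λ e → trans (x≗μp e) (combination-hull-coefficients q∈hull μ e)
  where q∈hull = S⊆hull ∘ p∈S

independent-in-hull⇒≤ : {B : Fin d → Vector k} {q : Fin r → Vector k} →
  (∀ i → AffineHull B (q i)) → AffinelyIndependent q → r ≤ d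
independent-in-hull⇒≤ {d} {r = r} {B} {q} q∈hull independent
  with homogeneous-dichotomy d r (λ t i → proj₁ (q∈hull i) t)
... | inj₂ (_ , r≤d) = r≤d
... | inj₁ (l , (j , lj≢0) , sol) = ⊥-elim (lj≢0 (independent l Σl≡0 comb≗0 j))
  where
  Σl≡0 : Σℚ l ≡ 0ℚ
  Σl≡0 = trans (sym (Σℚ-hull-coefficients q∈hull l)) (Σℚ-zero sol)
  comb≗0 : combination l q ≗ const 0ℚ
  comb≗0 e = trans (combination-hull-coefficients q∈hull l e)
                   (Σℚ-zero (λ t → trans (cong (_* B t e) (sol t)) (*-zeroˡ (B t e))))

AffineHull-resp-≗ : {B : Fin d → Vector k} {x y : Vector k} → x ≗ y → AffineHull B y → AffineHull B x
AffineHull-resp-≗ x≗y (a , Σa≡1 , y≗aB) = a , Σa≡1 , λ e → trans (x≗y e) (y≗aB e)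

AffineHull-∷ : {B : Fin d → Vector k} (w : Vector k) → AffineHull B ⊆ AffineHull (w ∷ᵛ B)
AffineHull-∷ {B = B} w (a , Σa≡1 , x≗aB) = (0ℚ ∷ᵛ a) , trans (+-identityˡ (Σℚ a)) Σa≡1 ,
  λ e → trans (x≗aB e) (sym (trans (cong (_+ combination a B e) (*-zeroˡ (w e))) (+-identityˡ _)))

∷∈AffineHull : {B : Fin d → Vector k} (w : Vector k) → AffineHull (w ∷ᵛ B) w
∷∈AffineHull {d} {B = B} w = e₀ , trans (sym (·-const1 (e₀ {d}))) (e₀·a≡a₀ {d} (const 1ℚ)) ,
  λ e → sym (e₀·a≡a₀ (λ t → (w ∷ᵛ B) t e))

independent-∷-head≡0⇒trivial : {B : Fin d → Vector k} {w : Vector k} → AffinelyIndependent B →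
  ∀ l → Σℚ l ≡ 0ℚ → combination l (w ∷ᵛ B) ≗ const 0ℚ → l zero ≡ 0ℚ → ∀ j → l j ≡ 0ℚ
independent-∷-head≡0⇒trivial {w = w} independent l Σl≡0 comb≗0 l₀≡0 = λ where
    zero    → l₀≡0
    (suc t) → independent (tail l) (drop-head l₀≡0 Σl≡0) (λ e → drop-head (l₀x≡0 (w e)) (comb≗0 e)) t
  where
  l₀x≡0 : ∀ x → l zero * x ≡ 0ℚ
  l₀x≡0 x = trans (cong (_* x) l₀≡0) (*-zeroˡ x)
  drop-head : ∀ {u y} → u ≡ 0ℚ → u + y ≡ 0ℚ → y ≡ 0ℚ
  drop-head {y = y} refl = trans (sym (+-identityˡ y))

independent∧dependent-∷⇒∈AffineHull : {B : Fin d → Vector k} {w : Vector k} →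
  AffinelyIndependent B → AffinelyDependent (w ∷ᵛ B) → AffineHull B w
independent∧dependent-∷⇒∈AffineHull {B = B} {w} independent (l , (j , lj≢0) , Σl≡0 , comb≗0)
  with l zero ≟ℚ 0ℚ
... | yes l₀≡0 = ⊥-elim (lj≢0 (independent-∷-head≡0⇒trivial independent l Σl≡0 comb≗0 l₀≡0 j))
... | no l₀≢0  = a , Σa≡1 , w≗aB
  where
  instance _ = ≢-nonZero l₀≢0
  c : ℚ
  c = - (1/ l zero)
  a : Fin _ → ℚ
  a t = c * l (suc t)
  Σa≡1 : Σℚ a ≡ 1ℚ
  Σa≡1 = trans (sym (*-distribˡ-Σℚ c (tail l)))
               (p*y+t≡0⇒-t/p≡y (l zero) (trans (cong (_+ Σℚ (tail l)) (*-identityʳ (l zero))) Σl≡0))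
  w≗aB : w ≗ combination a B
  w≗aB e = sym (begin
    combination a B e                   ≡⟨ Σℚ-cong (λ t → *-assoc c (l (suc t)) (B t e)) ⟩
    Σℚ (λ t → c * (l (suc t) * B t e))  ≡⟨ *-distribˡ-Σℚ c (λ t → l (suc t) * B t e) ⟨
    c * combination (tail l) B e        ≡⟨ p*y+t≡0⇒-t/p≡y (l zero) (comb≗0 e) ⟩
    w e                                 ∎)
    where open ≡-Reasoning

record IndependentFamily (S : Subset k) (d : ℕ) : Set where
  field
    point       : Fin (suc d) → Vector k
    point∈S     : ∀ t → S (point t)
    independent : AffinelyIndependent point

  hull : Subset k
  hull = AffineHull point

open IndependentFamily

SpanningFamily : (S X : Subset k) → ℕ → Set
SpanningFamily S X d = Σ[ F ∈ IndependentFamily S d ] X ⊆ hull F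

AffineBasis : Subset k → ℕ → Set
AffineBasis S = SpanningFamily S S

Listed : List (Vector k) → Subset k
Listed L x = Any (x ≗_) L

module _ {S : Subset k} where

  single-family : ∀ {w} → S w → SpanningFamily S (Listed []) 0
  single-family {w} w∈S = record
    { point       = const w
    ; point∈S     = const w∈S
    ; independent = λ { l Σl≡0 _ zero → trans (sym (+-identityʳ (l zero))) Σl≡0 }
    } , λ ()

  add-point : ∀ {X x} → SpanningFamily S X d → S x → ∃ (SpanningFamily S (λ y → y ≗ x ⊎ X y))
  add-point {d} {x = x} (F , X⊆F) x∈S with dependent⊎independent (x ∷ᵛ point F)
  ... | inj₁ dependent = d , F , λ where
    (inj₁ y≗x) → AffineHull-resp-≗ {B = point F} y≗x
                   (independent∧dependent-∷⇒∈AffineHull {B = point F} (independent F) dependent)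
    (inj₂ y∈X) → X⊆F y∈X
  ... | inj₂ independent′ = suc d , F′ , λ
    { (inj₁ y≗x) → AffineHull-resp-≗ {B = point F′} y≗x (∷∈AffineHull {B = point F} x)
    ; (inj₂ y∈X) → AffineHull-∷ {B = point F} x (X⊆F y∈X)
    }
    where
    F′ : IndependentFamily S (suc d)
    F′ = record
      { point       = x ∷ᵛ point F
      ; point∈S     = λ { zero → x∈S ; (suc t) → point∈S F t }
      ; independent = independent′
      }

  listed-family : ∀ {w L} → S w → All S L → ∃ (SpanningFamily S (Listed L))
  listed-family w∈S []          = 0 , single-family w∈S
  listed-family w∈S (x∈S ∷ L⊆S) with add-point (proj₂ (listed-family w∈S L⊆S)) x∈S
  ... | d , F , X⊆F = d , F , λ where
    (here y≗x)  → X⊆F (inj₁ y≗x)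
    (there y∈L) → X⊆F (inj₂ y∈L)

  listed⇒AffineBasis : ∀ {w L} → S w → All S L → S ⊆ Listed L → ∃ (AffineBasis S)
  listed⇒AffineBasis w∈S L⊆S S⊆L with listed-family w∈S L⊆S
  ... | d , F , L⊆F = d , F , L⊆F ∘ S⊆L

AffineBasis⇒HasDim : {S : Subset k} → AffineBasis S d → HasDim S d
AffineBasis⇒HasDim (F , S⊆F) =
  (point F , point∈S F , independent F) ,
  λ _ q q∈S q-independent → independent-in-hull⇒≤ {B = point F} (S⊆F ∘ q∈S) q-independent

S⊆conv : {S : Subset k} → S ⊆ conv S
S⊆conv {x = x} x∈S = 1 , const 1ℚ , const x , const x∈S , const (nonNegative⁻¹ 1ℚ) , +-identityʳ 1ℚ ,
  λ e → sym (trans (+-identityʳ (1ℚ * x e)) (*-identityˡ (x e)))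

conv-AffineBasis : {S : Subset k} → AffineBasis S d → AffineBasis (conv S) d
conv-AffineBasis {S = S} (F , S⊆F) = F′ , conv⊆AffineHull {S = S} {B = point F} S⊆F
  where
  F′ : IndependentFamily (conv S) _
  F′ = record { point = point F ; point∈S = S⊆conv {S = S} ∘ point∈S F ; independent = independent F }

Linear : (Vector k → ℚ) → Set
Linear {k} ℓ = ∀ {r} (μ : Fin r → ℚ) (p : Fin r → Vector k) {x} → x ≗ combination μ p → ℓ x ≡ μ · (ℓ ∘ p)

-- The empty combination is the zero vector.
Linear⇒zero : {ℓ : Vector k → ℚ} → Linear ℓ → ∀ {x} → x ≗ const 0ℚ → ℓ x ≡ 0ℚ
Linear⇒zero linear = linear {0} (λ ()) (λ ())

ΣℚOver-linear : (P : Fin k → Set) (P? : ∀ i → Dec (P i)) → Linear (ΣℚOver P P?)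
ΣℚOver-linear P P? μ p {x} x≗μp = begin
  ΣℚOver P P? x                                ≡⟨ ΣℚOver≡Σℚ-onlyIf P P? x ⟩
  Σℚ (λ e → onlyIf (P? e) (x e))               ≡⟨ Σℚ-cong onlyIf-x≡ ⟩
  Σℚ (λ e → Σℚ (λ i → μ i * restricted i e))  ≡⟨ Σℚ-comm (λ e i → μ i * restricted i e) ⟩
  Σℚ (λ i → Σℚ (λ e → μ i * restricted i e))  ≡⟨ Σℚ-cong (λ i → *-distribˡ-Σℚ (μ i) (restricted i)) ⟨
  Σℚ (λ i → μ i * Σℚ (restricted i))          ≡⟨ Σℚ-cong (λ i → cong (μ i *_) (ΣℚOver≡Σℚ-onlyIf P P? (p i))) ⟨
  Σℚ (λ i → μ i * ΣℚOver P P? (p i))          ∎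
  where
  open ≡-Reasoning
  restricted : Fin _ → Vector _
  restricted i e = onlyIf (P? e) (p i e)
  onlyIf-x≡ : ∀ e → onlyIf (P? e) (x e) ≡ Σℚ (λ i → μ i * restricted i e)
  onlyIf-x≡ e = trans (cong (onlyIf (P? e)) (x≗μp e)) (onlyIf-· (P? e) μ (λ i → p i e))

Level : (Vector k → ℚ) → ℚ → Subset k
Level ℓ c x = ℓ x ≡ c

conv⊆Level : {ℓ : Vector k → ℚ} {S : Subset k} {c : ℚ} → Linear ℓ → S ⊆ Level ℓ c → conv S ⊆ Level ℓ c
conv⊆Level {ℓ = ℓ} {c = c} linear S⊆level (r , μ , p , p∈S , _ , Σμ≡1 , x≗μp) = begin
  ℓ _                       ≡⟨ linear μ p x≗μp ⟩
  Σℚ (λ i → μ i * ℓ (p i))  ≡⟨ Σℚ-cong (λ i → cong (μ i *_) (S⊆level (p∈S i))) ⟩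
  Σℚ (λ i → μ i * c)        ≡⟨ *-distribʳ-Σℚ c μ ⟨
  Σℚ μ * c                  ≡⟨ cong (_* c) Σμ≡1 ⟩
  1ℚ * c                    ≡⟨ *-identityˡ c ⟩
  c                         ∎
  where open ≡-Reasoning

-- Apply ℓ to a vanishing combination: ℓ is 0 at zeroVec and c on B, so c Σₜ lₜ₊₁ = 0.
zero∷-independent : {ℓ : Vector k → ℚ} {c : ℚ} {B : Fin d → Vector k} → Linear ℓ → c ≢ 0ℚ →
  (∀ t → ℓ (B t) ≡ c) → AffinelyIndependent B → AffinelyIndependent (zeroVec ∷ᵛ B)
zero∷-independent {ℓ = ℓ} {c} {B} linear c≢0 ℓB≡c independent l Σl≡0 comb≗0 =
  independent-∷-head≡0⇒trivial {B = B} independent l Σl≡0 comb≗0 l₀≡0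
  where
  instance _ = ≢-nonZero c≢0
  ℓ0≡0 : ℓ zeroVec ≡ 0ℚ
  ℓ0≡0 = Linear⇒zero linear (λ _ → refl)
  c*Σtail≡0 : c * Σℚ (tail l) ≡ 0ℚ
  c*Σtail≡0 = begin
    c * Σℚ (tail l)
      ≡⟨ trans (*-comm c (Σℚ (tail l))) (*-distribʳ-Σℚ c (tail l)) ⟩
    Σℚ (λ t → l (suc t) * c)
      ≡⟨ +-identityˡ (Σℚ (λ t → l (suc t) * c)) ⟨
    0ℚ + Σℚ (λ t → l (suc t) * c)
      ≡⟨ cong₂ _+_ (trans (cong (l zero *_) ℓ0≡0) (*-zeroʳ (l zero)))
                   (Σℚ-cong (λ t → cong (l (suc t) *_) (ℓB≡c t))) ⟨
    l · (ℓ ∘ (zeroVec ∷ᵛ B))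
      ≡⟨ linear l (zeroVec ∷ᵛ B) (sym ∘ comb≗0) ⟨
    ℓ zeroVec
      ≡⟨ ℓ0≡0 ⟩
    0ℚ
      ∎
    where open ≡-Reasoning
  l₀≡0 : l zero ≡ 0ℚ
  l₀≡0 = trans (sym (+-identityʳ (l zero))) (trans (cong (l zero +_) (sym (p*q≡0⇒q≡0 c c*Σtail≡0))) Σl≡0)

join-zero : {ℓ : Vector k → ℚ} {c : ℚ} {S : Subset k} → Linear ℓ → c ≢ 0ℚ → S ⊆ Level ℓ c →
  AffineBasis S d → AffineBasis (S ∪ singleton zeroVec) (suc d)
join-zero {d = d} {S = S} linear c≢0 S⊆level (F , S⊆F) = F′ , λ where
    (inj₁ x∈S) → AffineHull-∷ {B = point F} zeroVec (S⊆F x∈S)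
    (inj₂ x≗0) → AffineHull-resp-≗ {B = zeroVec ∷ᵛ point F} x≗0 (∷∈AffineHull {B = point F} zeroVec)
  where
  F′ : IndependentFamily (S ∪ singleton zeroVec) (suc d)
  F′ = record
    { point       = zeroVec ∷ᵛ point F
    ; point∈S     = λ { zero → inj₂ (λ _ → refl) ; (suc t) → inj₁ (point∈S F t) }
    ; independent = zero∷-independent linear c≢0 (S⊆level ∘ point∈S F) (independent F)
    }

private
  variable
    A : Set
    x y : A
    xs : List A

length≡1⇒∈-unique : length xs ≡ 1 → x ∈ xs → y ∈ xs → x ≡ y
length≡1⇒∈-unique {xs = _ ∷ []} _ (here refl) (here refl) = refl

length≡1⇒nonempty : length xs ≡ 1 → ∃ (_∈ xs)
length≡1⇒nonempty {xs = x ∷ []} _ = x , here refl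

unique∧constant⇒length≡1 : Unique xs → x ∈ xs → (∀ {y} → y ∈ xs → y ≡ x) → length xs ≡ 1
unique∧constant⇒length≡1 {xs = _ ∷ []}    _                 _ _        = refl
unique∧constant⇒length≡1 {xs = _ ∷ _ ∷ _} ((y≢y′ ∷ _) ∷ _) _ constant =
  ⊥-elim (y≢y′ (trans (constant (here refl)) (sym (constant (there (here refl))))))

0<length-∷ʳ : ∀ xs → 0 < length (xs ++ x ∷ [])
0<length-∷ʳ []      = s≤s z≤n
0<length-∷ʳ (_ ∷ _) = s≤s z≤n

lookup-injective : Unique xs → ∀ {i j} → lookup xs i ≡ lookup xs j → i ≡ j
lookup-injective (_  ∷ _)  {zero}  {zero}  _  = refl
lookup-injective (x∉ ∷ _)  {zero}  {suc j} eq = ⊥-elim (All.lookup x∉ (∈-lookup j) eq)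
lookup-injective (x∉ ∷ _)  {suc i} {zero}  eq = ⊥-elim (All.lookup x∉ (∈-lookup i) (sym eq))
lookup-injective (_  ∷ uq) {suc i} {suc j} eq = cong suc (lookup-injective uq eq)

unique⇒length≤ : ∀ {n} {xs : List (Fin n)} → Unique xs → length xs ≤ n
unique⇒length≤ uq = injective⇒≤ (lookup-injective uq)

-- Graphs, walks and leaves

module _ (G : Graph) where

  open import Data.List.Membership.DecPropositional (_≟ᶠ_ {n G}) using (_∈?_)
  open import Data.List.Relation.Unary.Unique.DecPropositional (_≟ᶠ_ {n G}) using (unique?)
  open import Data.List.Membership.DecPropositional (_≟ᶠ_ {m G}) using () renaming (_∈?_ to _∈ᴱ?_)

  private
    V = Vertex G
    E = Edge G
    variable
      u v w z : V
      e f : E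
      vs : List V
      es : List E

  Incident : E → V → Set
  Incident e v = src G e ≡ v ⊎ tgt G e ≡ v

  incidentEdges : V → List E
  incidentEdges v = filter (incident? G v) (allFin (m G))

  ∈-incidentEdges⁺ : Incident e v → e ∈ incidentEdges v
  ∈-incidentEdges⁺ {e} {v} = ∈-filter⁺ (incident? G v) (∈-allFin e)

  ∈-incidentEdges⁻ : e ∈ incidentEdges v → Incident e v
  ∈-incidentEdges⁻ {v = v} = proj₂ ∘ ∈-filter⁻ (incident? G v) {xs = allFin (m G)}

  leaf-incident-unique : IsLeaf G v → Incident e v → Incident f v → e ≡ f
  leaf-incident-unique leaf e∋v f∋v = length≡1⇒∈-unique leaf (∈-incidentEdges⁺ e∋v) (∈-incidentEdges⁺ f∋v)

  leaf-edge : IsLeaf G v → ∃ λ e → Incident e v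
  leaf-edge leaf with length≡1⇒nonempty leaf
  ... | e , e∈ = e , ∈-incidentEdges⁻ e∈

  incident-unique⇒leaf : Incident e v → (∀ {f} → Incident f v → f ≡ e) → IsLeaf G v
  incident-unique⇒leaf {v = v} e∋v unique = unique∧constant⇒length≡1
    (filter⁺ (incident? G v) (allFin⁺ (m G))) (∈-incidentEdges⁺ e∋v) (unique ∘ ∈-incidentEdges⁻)

  incident-leaf⇒IsLeafEdge : Incident e v → IsLeaf G v → IsLeafEdge G e
  incident-leaf⇒IsLeafEdge (inj₁ refl) = inj₁
  incident-leaf⇒IsLeafEdge (inj₂ refl) = inj₂

  joins-sym : Joins G e u w → Joins G e w u
  joins-sym (inj₁ (s , t)) = inj₂ (s , t)
  joins-sym (inj₂ (s , t)) = inj₁ (s , t)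

  joins⇒incidentˡ : Joins G e u w → Incident e u
  joins⇒incidentˡ (inj₁ (s , _)) = inj₁ s
  joins⇒incidentˡ (inj₂ (_ , t)) = inj₂ t

  joins⇒incidentʳ : Joins G e u w → Incident e w
  joins⇒incidentʳ = joins⇒incidentˡ ∘ joins-sym

  incident⇒joins : Incident e v → ∃ (Joins G e v)
  incident⇒joins {e} (inj₁ s) = tgt G e , inj₁ (s , refl)
  incident⇒joins {e} (inj₂ t) = src G e , inj₂ (refl , t)

  joins-incident⇒endpoint : Joins G e u w → Incident e z → z ≡ u ⊎ z ≡ w
  joins-incident⇒endpoint (inj₁ (s , _)) (inj₁ s′) = inj₁ (trans (sym s′) s)
  joins-incident⇒endpoint (inj₁ (_ , t)) (inj₂ t′) = inj₂ (trans (sym t′) t)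
  joins-incident⇒endpoint (inj₂ (s , _)) (inj₁ s′) = inj₂ (trans (sym s′) s)
  joins-incident⇒endpoint (inj₂ (_ , t)) (inj₂ t′) = inj₁ (trans (sym t′) t)

  joins-irreflexive : ¬ Joins G e u u
  joins-irreflexive {e} (inj₁ (s , t)) = loopless G e (trans s (sym t))
  joins-irreflexive {e} (inj₂ (s , t)) = loopless G e (trans s (sym t))

  joins-functional : Joins G e u w → Joins G e u z → w ≡ z
  joins-functional e∶uw e∶uz with joins-incident⇒endpoint e∶uw (joins⇒incidentʳ e∶uz)
  ... | inj₁ refl = ⊥-elim (joins-irreflexive e∶uz)
  ... | inj₂ z≡w  = sym z≡w

  joins-unique : Joins G e u w → Joins G f u w → e ≡ f
  joins-unique (inj₁ (s , t)) (inj₁ (s′ , t′)) = noParallel G _ _ (inj₁ (trans s (sym s′) , trans t (sym t′)))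
  joins-unique (inj₁ (s , t)) (inj₂ (s′ , t′)) = noParallel G _ _ (inj₂ (trans s (sym t′) , trans t (sym s′)))
  joins-unique (inj₂ (s , t)) (inj₁ (s′ , t′)) = noParallel G _ _ (inj₂ (trans s (sym t′) , trans t (sym s′)))
  joins-unique (inj₂ (s , t)) (inj₂ (s′ , t′)) = noParallel G _ _ (inj₁ (trans s (sym s′) , trans t (sym t′)))

  joins? : ∀ e u w → Dec (Joins G e u w)
  joins? e u w = ((src G e ≟ᶠ u) ×-dec (tgt G e ≟ᶠ w)) ⊎-dec ((src G e ≟ᶠ w) ×-dec (tgt G e ≟ᶠ u))

  walk-start∈ : Walk G u v vs es → u ∈ vs
  walk-start∈ here         = here refl
  walk-start∈ (step _ _ _) = here refl

  walk-end∈ : Walk G u v vs es → v ∈ vs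
  walk-end∈ here         = here refl
  walk-end∈ (step _ _ r) = there (walk-end∈ r)

  walk-head : Walk G u v (w ∷ vs) es → u ≡ w
  walk-head here         = refl
  walk-head (step _ _ _) = refl

  walk-start-unique : ∀ {u′ v′ es′} → Walk G u v vs es → Walk G u′ v′ vs es′ → u ≡ u′
  walk-start-unique here         here         = refl
  walk-start-unique here         (step _ _ _) = refl
  walk-start-unique (step _ _ _) here         = refl
  walk-start-unique (step _ _ _) (step _ _ _) = refl

  walk-edges-unique : ∀ {u′ v′ es′} → Walk G u v vs es → Walk G u′ v′ vs es′ → es ≡ es′
  walk-edges-unique here            here               = refl
  walk-edges-unique here            (step _ _ ())
  walk-edges-unique (step _ _ ())   here
  walk-edges-unique (step _ e∶uw r) (step _ e′∶uw′ r′) with walk-start-unique r r′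
  ... | refl = cong₂ _∷_ (joins-unique e∶uw e′∶uw′) (walk-edges-unique r r′)

  walk? : ∀ u v vs → Dec (∃ (Walk G u v vs))
  walk? u v []       = no λ { (_ , ()) }
  walk? u v (x ∷ []) with u ≟ᶠ x | v ≟ᶠ x
  ... | yes refl | yes refl = yes ([] , here)
  ... | no u≢x   | _        = no λ { (_ , here) → u≢x refl ; (_ , step _ _ ()) }
  ... | yes _    | no v≢x   = no λ { (_ , here) → v≢x refl ; (_ , step _ _ ()) }
  walk? u v (x ∷ y ∷ vs) with u ≟ᶠ x | any? (λ e → joins? e x y) | walk? y v (y ∷ vs)
  ... | yes refl | yes (e , e∶uy) | yes (es , r) = yes (e ∷ es , step e e∶uy r)
  ... | no u≢x   | _              | _            = no λ { (_ , step _ _ _) → u≢x refl }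
  ... | yes refl | no noEdge      | _            =
    no λ { (_ , step e e∶uw r) → noEdge (e , subst (Joins G e u) (walk-head r) e∶uw) }
  ... | yes refl | yes _          | no noWalk    =
    no λ { (_ , step _ _ r) → noWalk (_ , subst (λ w → Walk G w v (y ∷ vs) _) (walk-head r) r) }

  walk-prefix : Walk G w v vs es → Unique vs → z ∈ vs →
    ∃₂ λ vs₁ es₁ → Walk G w z vs₁ es₁ × Unique vs₁ × (∀ {y} → y ∈ vs₁ → y ∈ vs)
  walk-prefix here         _ (here refl) = _ , _ , here , [] ∷ [] , λ y∈ → y∈
  walk-prefix (step _ _ _) _ (here refl) = _ , _ , here , [] ∷ [] , λ { (here refl) → here refl }
  walk-prefix (step e e∶wx r) (w∉ ∷ uq) (there z∈) with walk-prefix r uq z∈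
  ... | vs₁ , es₁ , r₁ , uq₁ , vs₁⊆ =
    _ ∷ vs₁ , e ∷ es₁ , step e e∶wx r₁ , All.tabulate (All.lookup w∉ ∘ vs₁⊆) ∷ uq₁ ,
    λ { (here refl) → here refl ; (there y∈) → there (vs₁⊆ y∈) }

  walk-snoc : Walk G w z vs es → Joins G f z u → Walk G w u (vs ++ u ∷ []) (es ++ f ∷ [])
  walk-snoc {f = f} here    f∶zu = step f f∶zu here
  walk-snoc (step e e∶wx r) f∶zu = step e e∶wx (walk-snoc r f∶zu)

  Stuck : V → List V → Set
  Stuck u vs = ∀ {f z} → Joins G f u z → z ∈ vs

  extend⊎stuck : ∀ u vs → (∃₂ λ f z → Joins G f u z × z ∉ vs) ⊎ Stuck u vs
  extend⊎stuck u vs with any? (λ f → any? (λ z → joins? f u z ×-dec ¬? (z ∈? vs)))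
  ... | yes (f , z , f∶uz , z∉) = inj₁ (f , z , f∶uz , z∉)
  ... | no none = inj₂ λ {f} {z} f∶uz → decidable-stable (z ∈? vs) (λ z∉ → none (f , z , f∶uz , z∉))

  MaximalPathTo : V → Set
  MaximalPathTo v = ∃ λ u → ∃₂ λ vs es → Walk G u v vs es × Unique vs × Stuck u vs

  -- The fuel never runs out: a path has at most n G vertices.
  grow : ∀ fuel → Walk G u v vs es → Unique vs → n G < length vs ℕ.+ fuel → MaximalPathTo v
  grow {vs = vs} zero _ uq n<∣vs∣ =
    ⊥-elim (ℕ.<⇒≱ (subst (n G <_) (ℕ.+-identityʳ (length vs)) n<∣vs∣) (unique⇒length≤ uq))
  grow {u} {vs = vs} (suc fuel) r uq n<∣vs∣+1+fuel with extend⊎stuck u vs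
  ... | inj₂ stuck = u , vs , _ , r , uq , stuck
  ... | inj₁ (f , z , f∶uz , z∉) = grow fuel (step f (joins-sym f∶uz) r) (¬Any⇒All¬ vs z∉ ∷ uq)
                                          (subst (n G <_) (ℕ.+-suc (length vs) fuel) n<∣vs∣+1+fuel)

  maximal-path-to : ∀ v → MaximalPathTo v
  maximal-path-to v = grow (suc (n G)) here ([] ∷ []) (s≤s (ℕ.n≤1+n (n G)))

  cycle-through : Joins G e u w → Walk G w z vs es → Unique vs → u ∉ vs → w ≢ z → Joins G f z u → Cycle G
  cycle-through _ here _ _ w≢w _ = ⊥-elim (w≢w refl)
  cycle-through {e} {u} {vs = vs} {es = es} {f} e∶uw r@(step {es = es₁} _ _ _) uq u∉ _ f∶zu =
    u , vs ++ u ∷ [] , e ∷ es ++ f ∷ [] , step e e∶uw (walk-snoc r f∶zu) ,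
    ++⁺ uq ([] ∷ []) u∉-disjoint , s≤s (s≤s (0<length-∷ʳ es₁))
    where
    u∉-disjoint : ∀ {y} → ¬ (y ∈ vs × y ∈ u ∷ [])
    u∉-disjoint (y∈ , here refl) = u∉ y∈

  stuck⇒leaf : Acyclic G → Walk G u v vs es → Unique vs → Stuck u vs → (∃ λ f → Incident f v) →
    IsLeaf G u × u ≢ v
  stuck⇒leaf _ here _ stuck (f , f∋u) with incident⇒joins f∋u
  ... | _ , f∶uz with stuck f∶uz
  ...   | here refl = ⊥-elim (joins-irreflexive f∶uz)
  stuck⇒leaf {u} acyclic (step {w = w} e e∶uw r) (u∉ ∷ uq) stuck _ =
    incident-unique⇒leaf (joins⇒incidentˡ e∶uw) only-e , λ u≡v → All.lookup u∉ (walk-end∈ r) u≡v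
    where
    only-e : ∀ {f} → Incident f u → f ≡ e
    only-e f∋u with incident⇒joins f∋u
    ... | z , f∶uz with stuck f∶uz
    ...   | here refl = ⊥-elim (joins-irreflexive f∶uz)
    ...   | there z∈ with z ≟ᶠ w
    ...     | yes refl = joins-unique f∶uz e∶uw
    ...     | no z≢w with walk-prefix r uq z∈
    ...       | _ , _ , r₁ , uq₁ , ⊆vs = ⊥-elim (acyclic (cycle-through e∶uw r₁ uq₁
                  (λ u∈vs₁ → All.lookup u∉ (⊆vs u∈vs₁) refl) (z≢w ∘ sym) (joins-sym f∶uz)))

  leaves-nonadjacent : IsTree G → 2 ≤ m G → IsLeaf G u → IsLeaf G v → u ≢ v → Incident e u → Incident e v → ⊥
  leaves-nonadjacent {u} {v} {e} (connected , _) (s≤s (s≤s _)) u-leaf v-leaf u≢v e∋u e∋v =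
    0≢1+n (trans (only-e zero) (sym (only-e (suc zero))))
    where
    e∶uv : Joins G e u v
    e∶uv with incident⇒joins e∋u
    ... | w , e∶uw with joins-incident⇒endpoint e∶uw e∋v
    ...   | inj₁ v≡u  = ⊥-elim (u≢v (sym v≡u))
    ...   | inj₂ refl = e∶uw
    at-ends⇒e : Incident f z → z ≡ u ⊎ z ≡ v → f ≡ e
    at-ends⇒e f∋z (inj₁ refl) = leaf-incident-unique u-leaf f∋z e∋u
    at-ends⇒e f∋z (inj₂ refl) = leaf-incident-unique v-leaf f∋z e∋v
    stays-at-ends : Walk G w z vs es → w ≡ u ⊎ w ≡ v → z ≡ u ⊎ z ≡ v
    stays-at-ends here at-end = at-end
    stays-at-ends (step f f∶wx r) at-end with at-ends⇒e (joins⇒incidentˡ f∶wx) at-end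
    ... | refl = stays-at-ends r (joins-incident⇒endpoint e∶uv (joins⇒incidentʳ f∶wx))
    only-e : ∀ f → f ≡ e
    only-e f = at-ends⇒e (inj₁ refl) (stays-at-ends (proj₂ (proj₂ (connected u (src G f)))) (inj₁ refl))

  first-edge-incident : Walk G u v vs (e ∷ es) → Incident e u
  first-edge-incident (step _ e∶uw _) = joins⇒incidentˡ e∶uw

  last-edge : Walk G u v vs (e ∷ es) → ∃ λ f → f ∈ e ∷ es × Incident f v
  last-edge (step e e∶uw here)        = e , here refl , joins⇒incidentʳ e∶uw
  last-edge (step _ _ r@(step _ _ _)) with last-edge r
  ... | f , f∈ , f∋v = f , there f∈ , f∋v

  -- The only edge at the leaf w leads back to u.
  entered-leaf⇒end : Joins G e u w → Walk G w v vs es → u ∉ vs → IsLeaf G w → w ≡ v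
  entered-leaf⇒end _ here _ _ = refl
  entered-leaf⇒end e∶uw (step f f∶wx r) u∉ w-leaf
    with leaf-incident-unique w-leaf (joins⇒incidentʳ e∶uw) (joins⇒incidentˡ f∶wx)
  ... | refl = ⊥-elim (u∉ (there (subst (_∈ _) (sym (joins-functional (joins-sym e∶uw) f∶wx)) (walk-start∈ r))))

  leaf-on-path⇒end : Walk G u v vs es → Unique vs → e ∈ es → Incident e z → IsLeaf G z → z ≡ u ⊎ z ≡ v
  leaf-on-path⇒end (step e e∶uw r) (u∉ ∷ _) (here refl) e∋z z-leaf with joins-incident⇒endpoint e∶uw e∋z
  ... | inj₁ z≡u  = inj₁ z≡u
  ... | inj₂ refl = inj₂ (entered-leaf⇒end e∶uw r (All¬⇒¬Any u∉) z-leaf)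
  leaf-on-path⇒end (step e e∶uw r) (u∉ ∷ uq) (there e∈) e∋z z-leaf with leaf-on-path⇒end r uq e∈ e∋z z-leaf
  ... | inj₁ refl = inj₂ (entered-leaf⇒end e∶uw r (All¬⇒¬Any u∉) z-leaf)
  ... | inj₂ z≡v  = inj₂ z≡v

  leaf-edges-of-leaf-path : IsTree G → 2 ≤ m G → IsLeaf G u → IsLeaf G v → u ≢ v →
    Walk G u v vs es → Unique vs →
    ∃₂ λ e₁ e₂ → e₁ ≢ e₂ × (IsLeafEdge G e₁ × e₁ ∈ es) × (IsLeafEdge G e₂ × e₂ ∈ es) ×
                 (∀ {e} → IsLeafEdge G e × e ∈ es → e ≡ e₁ ⊎ e ≡ e₂)
  leaf-edges-of-leaf-path _ _ _ _ u≢u here _ = ⊥-elim (u≢u refl)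
  leaf-edges-of-leaf-path {es = e₁ ∷ es} tree 2≤m u-leaf v-leaf u≢v r@(step _ _ _) uq with last-edge r
  ... | e₂ , e₂∈ , e₂∋v =
    e₁ , e₂ , e₁≢e₂ ,
    (incident-leaf⇒IsLeafEdge e₁∋u u-leaf , here refl) , (incident-leaf⇒IsLeafEdge e₂∋v v-leaf , e₂∈) , only
    where
    e₁∋u = first-edge-incident r
    e₁≢e₂ : e₁ ≢ e₂
    e₁≢e₂ refl = leaves-nonadjacent tree 2≤m u-leaf v-leaf u≢v e₁∋u e₂∋v
    at-end : Incident e z → IsLeaf G z → e ∈ e₁ ∷ es → e ≡ e₁ ⊎ e ≡ e₂
    at-end e∋z z-leaf e∈ with leaf-on-path⇒end r uq e∈ e∋z z-leaf
    ... | inj₁ refl = inj₁ (leaf-incident-unique u-leaf e∋z e₁∋u)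
    ... | inj₂ refl = inj₂ (leaf-incident-unique v-leaf e∋z e₂∋v)
    only : ∀ {e} → IsLeafEdge G e × e ∈ e₁ ∷ es → e ≡ e₁ ⊎ e ≡ e₂
    only (inj₁ src-leaf , e∈) = at-end (inj₁ refl) src-leaf e∈
    only (inj₂ tgt-leaf , e∈) = at-end (inj₂ refl) tgt-leaf e∈

  -- Path vectors

  edgeIndicator : List E → Vector (m G)
  edgeIndicator es e = onlyIf (e ∈ᴱ? es) 1ℚ

  edgeIndicator-spec : ∀ es e → (e ∈ es → edgeIndicator es e ≡ 1ℚ) × (e ∉ es → edgeIndicator es e ≡ 0ℚ)
  edgeIndicator-spec es e = onlyIf-yes (e ∈ᴱ? es) , onlyIf-no (e ∈ᴱ? es)

  spec⇒≗edgeIndicator : ∀ {x : Vector (m G)} → (∀ e → (e ∈ es → x e ≡ 1ℚ) × (e ∉ es → x e ≡ 0ℚ)) →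
    x ≗ edgeIndicator es
  spec⇒≗edgeIndicator {es} spec e with e ∈ᴱ? es
  ... | yes e∈ = proj₁ (spec e) e∈
  ... | no e∉  = proj₂ (spec e) e∉

  Candidate : Set
  Candidate = V × V × List V

  LeafPath : Candidate → Set
  LeafPath (i , j , vs) = IsLeaf G i × IsLeaf G j × i ≢ j × Unique vs × ∃ (Walk G i j vs)

  leafPath? : ∀ t → Dec (LeafPath t)
  leafPath? (i , j , vs) =
    (degree G i ℕ.≟ 1) ×-dec (degree G j ℕ.≟ 1) ×-dec ¬? (i ≟ᶠ j) ×-dec unique? vs ×-dec walk? i j vs

  leafPathVector : ∀ {t} → LeafPath t → Vector (m G)
  leafPathVector (_ , _ , _ , _ , es , _) = edgeIndicator es

  leafPathVector-unique : ∀ {t} (lp lp′ : LeafPath t) → leafPathVector lp ≗ leafPathVector lp′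
  leafPathVector-unique (_ , _ , _ , _ , _ , r) (_ , _ , _ , _ , _ , r′) e =
    cong (λ es → edgeIndicator es e) (walk-edges-unique r r′)

  leafPathVector∈PathVectors : ∀ {t} (lp : LeafPath t) → PathVectors G (leafPathVector lp)
  leafPathVector∈PathVectors {i , j , vs} (i-leaf , j-leaf , i≢j , uq , es , r) =
    i , j , i-leaf , j-leaf , i≢j , vs , es , (r , uq) , edgeIndicator-spec es

  PathVectors⇒LeafPath : ∀ {x} → PathVectors G x → ∃ λ t → Σ (LeafPath t) λ lp → x ≗ leafPathVector lp
  PathVectors⇒LeafPath (i , j , i-leaf , j-leaf , i≢j , vs , es , (r , uq) , spec) =
    (i , j , vs) , (i-leaf , j-leaf , i≢j , uq , es , r) , spec⇒≗edgeIndicator spec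

  listsUpTo : ℕ → List (List V)
  listsUpTo zero    = [] ∷ []
  listsUpTo (suc k) = [] ∷ map (uncurry _∷_) (cartesianProduct (allFin (n G)) (listsUpTo k))

  ∈-listsUpTo : ∀ {k} → length vs ≤ k → vs ∈ listsUpTo k
  ∈-listsUpTo {[]}     {zero}  _            = here refl
  ∈-listsUpTo {[]}     {suc k} _            = here refl
  ∈-listsUpTo {x ∷ vs} {suc k} (s≤s ∣vs∣≤k) =
    there (∈-map⁺ (uncurry _∷_) (∈-cartesianProduct⁺ (∈-allFin x) (∈-listsUpTo ∣vs∣≤k)))

  candidates : List Candidate
  candidates = cartesianProduct (allFin (n G)) (cartesianProduct (allFin (n G)) (listsUpTo (n G)))

  ∈-candidates : ∀ i j → Unique vs → (i , j , vs) ∈ candidates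
  ∈-candidates i j uq =
    ∈-cartesianProduct⁺ (∈-allFin i) (∈-cartesianProduct⁺ (∈-allFin j) (∈-listsUpTo (unique⇒length≤ uq)))

  leafPathVectors : List Candidate → List (Vector (m G))
  leafPathVectors []       = []
  leafPathVectors (t ∷ ts) with leafPath? t
  ... | yes lp = leafPathVector lp ∷ leafPathVectors ts
  ... | no _   = leafPathVectors ts

  leafPathVectors⊆PathVectors : ∀ ts → All (PathVectors G) (leafPathVectors ts)
  leafPathVectors⊆PathVectors []       = []
  leafPathVectors⊆PathVectors (t ∷ ts) with leafPath? t
  ... | yes lp = leafPathVector∈PathVectors lp ∷ leafPathVectors⊆PathVectors ts
  ... | no _   = leafPathVectors⊆PathVectors ts

  ∈-leafPathVectors : ∀ {t ts} → t ∈ ts → (lp : LeafPath t) → Listed (leafPathVectors ts) (leafPathVector lp)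
  ∈-leafPathVectors {ts = t ∷ _} (here refl) lp with leafPath? t
  ... | yes lp′ = here (leafPathVector-unique lp lp′)
  ... | no ¬lp  = ⊥-elim (¬lp lp)
  ∈-leafPathVectors {ts = t′ ∷ _} (there t∈) lp with leafPath? t′
  ... | yes _ = there (∈-leafPathVectors t∈ lp)
  ... | no _  = ∈-leafPathVectors t∈ lp

  PathVectors⊆Listed : PathVectors G ⊆ Listed (leafPathVectors candidates)
  PathVectors⊆Listed x∈ with PathVectors⇒LeafPath x∈
  ... | (i , j , vs) , lp@(_ , _ , _ , uq , _) , x≗lp =
    Any.map (λ lp≗y e → trans (x≗lp e) (lp≗y e)) (∈-leafPathVectors (∈-candidates i j uq) lp)

  leafPath-exists : Acyclic G → 0 < m G → ∃ LeafPath
  leafPath-exists acyclic (s≤s _) with maximal-path-to (src G zero)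
  ... | u , _ , _ , r , uq , stuck with stuck⇒leaf acyclic r uq stuck (zero , inj₁ refl)
  ... | u-leaf , _ with maximal-path-to u
  ... | u′ , vs′ , es′ , r′ , uq′ , stuck′ with stuck⇒leaf acyclic r′ uq′ stuck′ (leaf-edge u-leaf)
  ... | u′-leaf , u′≢u = (u′ , u , vs′) , u′-leaf , u-leaf , u′≢u , uq′ , es′ , r′

  PathVectors-AffineBasis : Acyclic G → 0 < m G → ∃ (AffineBasis (PathVectors G))
  PathVectors-AffineBasis acyclic 0<m =
    listed⇒AffineBasis (leafPathVector∈PathVectors (proj₂ (leafPath-exists acyclic 0<m)))
                       (leafPathVectors⊆PathVectors candidates) PathVectors⊆Listed

  PathVectors⊆Level : IsTree G → 2 ≤ m G → PathVectors G ⊆ Level (leafEdgeSum G) 2ℚ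
  PathVectors⊆Level tree 2≤m {x} (i , j , i-leaf , j-leaf , i≢j , vs , es , (r , uq) , spec)
    with leaf-edges-of-leaf-path tree 2≤m i-leaf j-leaf i≢j r uq
  ... | e₁ , e₂ , e₁≢e₂ , on₁ , on₂ , only = begin
    leafEdgeSum G x
      ≡⟨ ΣℚOver≡Σℚ-onlyIf (IsLeafEdge G) leaf? x ⟩
    Σℚ (λ e → onlyIf (leaf? e) (x e))
      ≡⟨ Σℚ-cong (λ e → cong (onlyIf (leaf? e)) (spec⇒≗edgeIndicator spec e)) ⟩
    Σℚ (λ e → onlyIf (leaf? e) (onlyIf (e ∈ᴱ? es) 1ℚ))
      ≡⟨ Σℚ-cong (λ e → onlyIf-onlyIf (leaf? e) (e ∈ᴱ? es) 1ℚ) ⟩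
    Σℚ (λ e → onlyIf (leaf? e ×-dec e ∈ᴱ? es) 1ℚ)
      ≡⟨ Σℚ-onlyIf-pair e₁≢e₂ (λ e → leaf? e ×-dec e ∈ᴱ? es) on₁ on₂ only ⟩
    2ℚ
      ∎
    where
    open ≡-Reasoning
    leaf? = isLeafEdge? G

proposition2p2 : (T : Graph) → IsTree T → 2 ≤ m T →
    ((x : Vector (m T)) → PathPolytope T x → leafEdgeSum T x ≡ 2ℚ)
    × Σ ℕ (λ d → HasDim (PathPolytope T) d × HasDim (conv (PathPolytope T ∪ singleton zeroVec)) (suc d))
proposition2p2 T tree@(_ , acyclic) 2≤m with PathVectors-AffineBasis T acyclic (ℕ.≤-trans (s≤s z≤n) 2≤m)
... | dim , vertex-basis =
  (λ _ → polytope⊆level) ,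
  dim , AffineBasis⇒HasDim polytope-basis ,
  AffineBasis⇒HasDim (conv-AffineBasis (join-zero linear 2ℚ≢0 polytope⊆level polytope-basis))
  where
  linear : Linear (leafEdgeSum T)
  linear = ΣℚOver-linear (IsLeafEdge T) (isLeafEdge? T)
  polytope⊆level : PathPolytope T ⊆ Level (leafEdgeSum T) 2ℚ
  polytope⊆level = conv⊆Level linear (PathVectors⊆Level T tree 2≤m)
  polytope-basis : AffineBasis (PathPolytope T) dim
  polytope-basis = conv-AffineBasis vertex-basis
  2ℚ≢0 : 2ℚ ≢ 0ℚ
  2ℚ≢0 ()
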